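{- For every $\mathbf i=(i_1,\dots,i_k)\in[s]^k$ and every $C\in\mathcal C(\mathbf i)$, $$|\mathbf{E}Y_C|\le 2^{\tilde n_C}\check p_C.$$ Moreover, if $\tilde n_C\le2$ then $\mathbf{E}Y_C=\check p_C$; in particular $\check p_C=0$ if $\tilde n_C=1$.
   Context: Let $n,\ell,k\ge1$ be integers and $p\in(0,1)$. Let $\mathcal M=\{M_1,\dots,M_s\}$ be the set of all $\ell$-matchings of the complete graph $K_{[n]}$. For $i\in[s]$, $X_i$ is the indicator that $M_i\subseteq\mathcal G(n,p)$ (binomial random graph on $[n]$ with edge probability $p$) and $Y_i=X_i-p^\ell$. Let $H_{\mathcal M}$ be the graph on $\mathcal M$ in which $M\neq M'$ are adjacent iff $M\cap M'\ne\emptyset$. For $\mathbf i\in[s]^k$, $\mathcal C(\mathbf i)$ is the set of components of the subgraph of $H_{\mathcal M}$ induced by $\{M_{i_1},\dots,M_{i_k}\}$. For $C\in\mathcal C(\mathbf i)$: $\tilde n_C=|\{j:M_{i_j}\in V(C)\}|$, $\tilde m_C=|\bigcup_{M\in C}M|$ (number of distinct edges in the union of the matchings of $C$), $Y_C=\prod_{j:M_{i_j}\in C}Y_{i_j}$, and $\check p_C=p^{\tilde m_C}-p^{\tilde n_C\ell}$ if $\tilde n_C\le2$, $\check p_C=p^{\tilde m_C}$ otherwise.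
   Formalization: The edge probability p of 𝒢(n,p) takes only rational values in (0,1). -}

module Defs where

open import Data.Nat as ℕ using (ℕ; zero; suc; _∸_)
open import Data.Bool using (Bool; true; false; if_then_else_)
open import Data.Fin as Fin using (Fin; toℕ)
open import Data.Fin.Subset as Sub using (Subset)
import Data.Fin.Subset.Properties as SubP
open import Data.Product using (_×_; _,_; proj₁; proj₂; ∃; ∃-syntax; Σ)
open import Data.Product.Properties using (≡-dec)
open import Data.List as List using (List; []; _∷_; _++_; map; length; filter; foldr; allFin; cartesianProduct)
import Data.List.Membership.Propositional as MemP
import Data.List.Membership.DecPropositional as MemD
open import Data.List.Relation.Unary.AllPairs using (AllPairs)
open import Data.List.Relation.Unary.All using (All; all?)
open import Data.List.Relation.Unary.Any using (any?)
open import Data.Rational as ℚ using (ℚ; 0ℚ; 1ℚ; _+_; _*_; _-_)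
open import Relation.Nullary using (¬_; does)
open import Relation.Nullary.Decidable using (_×-dec_)
open import Relation.Binary.PropositionalEquality using (_≡_; _≢_)
open import Relation.Binary.Construct.Closure.ReflexiveTransitive using (Star)
open import Relation.Binary.Definitions using (DecidableEquality)
open import Function.Bundles using (_⇔_)

infixr 8 _^ᵠ_
_^ᵠ_ : ℚ → ℕ → ℚ
x ^ᵠ zero  = 1ℚ
x ^ᵠ suc m = x * (x ^ᵠ m)

-- Edges of the complete graph K_[n]: pairs (a , b) with a < b

Edge : ℕ → Set
Edge n = Fin n × Fin n

IsEdge : ∀ {n} → Edge n → Set
IsEdge (a , b) = toℕ a ℕ.< toℕ b

_≟ᴱ_ : ∀ {n} → DecidableEquality (Edge n)
_≟ᴱ_ = ≡-dec Fin._≟_ Fin._≟_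

allEdges : (n : ℕ) → List (Edge n)
allEdges n = filter (λ e → toℕ (proj₁ e) ℕ.<? toℕ (proj₂ e))
                    (cartesianProduct (allFin n) (allFin n))

N : ℕ → ℕ
N n = length (allEdges n)

VertexDisjoint : ∀ {n} → Edge n → Edge n → Set
VertexDisjoint (a , b) (c , d) = (a ≢ c) × (a ≢ d) × (b ≢ c) × (b ≢ d)

record Matching (n ℓ : ℕ) : Set where
  field
    edges    : List (Edge n)
    size     : length edges ≡ ℓ
    valid    : All IsEdge edges
    disjoint : AllPairs VertexDisjoint edges
open Matching public

-- The probability space G(n,p): graphs = subsets of allEdges n

subsets : ∀ {A : Set} → List A → List (List A)
subsets []       = [] ∷ []
subsets (x ∷ xs) = subsets xs ++ map (x ∷_) (subsets xs)

sumℚ : List ℚ → ℚ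
sumℚ = foldr _+_ 0ℚ

𝔼 : (n : ℕ) (p : ℚ) → (List (Edge n) → ℚ) → ℚ
𝔼 n p f = sumℚ (map (λ G → (p ^ᵠ length G) * ((1ℚ - p) ^ᵠ (N n ∸ length G)) * f G)
                    (subsets (allEdges n)))

module _ {n : ℕ} where
  open MemD (_≟ᴱ_ {n}) using (_∈?_)

  X : ∀ {ℓ} → Matching n ℓ → List (Edge n) → ℚ
  X M G = if does (all? (λ e → e ∈? G) (edges M)) then 1ℚ else 0ℚ

  Y : ∀ {ℓ} → ℚ → Matching n ℓ → List (Edge n) → ℚ
  Y {ℓ} p M G = X M G - p ^ᵠ ℓ

  module _ {ℓ k : ℕ} (ms : Fin k → Matching n ℓ) where
    open MemP using (_∈_)

    -- positions j, j' whose matchings share an edge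
    -- (adjacency in H_M, or the same vertex of H_M since ℓ ≥ 1)
    Share : Fin k → Fin k → Set
    Share j j' = ∃[ e ] (e ∈ edges (ms j) × e ∈ edges (ms j'))

    -- S ⊆ [k] is the set of positions j with M_{i_j} in a component C
    -- of the subgraph of H_M induced by {M_{i_1},…,M_{i_k}}
    IsComponent : Subset k → Set
    IsComponent S = (∃[ j ] j Sub.∈ S)
                  × (∀ j j' → j Sub.∈ S → (j' Sub.∈ S ⇔ Star Share j j'))

    ñ : Subset k → ℕ
    ñ S = Sub.∣ S ∣

    m̃ : Subset k → ℕ
    m̃ S = length (filter (λ e → any? (λ j → SubP._∈?_ j S ×-dec (e ∈? edges (ms j))) (allFin k))
                          (allEdges n))

    Yᶜ : ℚ → Subset k → List (Edge n) → ℚ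
    Yᶜ p S G = foldr (λ j acc → (if does (SubP._∈?_ j S) then Y p (ms j) G else 1ℚ) * acc)
                     1ℚ (allFin k)

    p̌ : ℚ → Subset k → ℚ
    p̌ p S = if does (ñ S ℕ.≤? 2) then p ^ᵠ m̃ S - p ^ᵠ (ñ S ℕ.* ℓ) else p ^ᵠ m̃ S

{-# OPTIONS --safe #-}

-- Let B range over the edge sets of the matchings of C and put q_B = p^|B|, so that
-- Y_C = ∏ (𝟙[B ⊆ G] − q_B).  Expanding one factor,
--   E[𝟙[A ⊆ G] (𝟙[B ⊆ G] − q_B) R] = E[𝟙[A ∪ B ⊆ G] R] − q_B E[𝟙[A ⊆ G] R],
-- and E[𝟙[A ⊆ G]] = p^|A|.  As |A ∪ B ∪ D| ≤ |B| + |A ∪ D|, induction on the number r of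
-- factors gives |E[𝟙[A ⊆ G] ∏ (𝟙[B ⊆ G] − q_B)]| ≤ 2^r p^|A ∪ ⋃B|, the bound for ñ_C ≥ 3.
-- With one or two factors the expansion is exact and yields 0, resp. p^m̃_C − p^(2ℓ), which
-- is nonnegative since m̃_C ≤ 2ℓ.

module Submission where

open import Defs
open import Data.Nat using (ℕ; _≤_)
open import Data.Fin using (Fin)
open import Data.Fin.Subset using (Subset)
open import Data.Product using (_×_)
open import Data.Rational using (ℚ; 0ℚ; 1ℚ; ∣_∣; _*_; _+_; _<_) renaming (_≤_ to _≤ℚ_)
open import Relation.Binary.PropositionalEquality using (_≡_)

open import Data.Nat as ℕ using (zero; suc; _∸_; z≤n; s≤s)
import Data.Nat.Properties as ℕP
open import Data.Bool using (true; false; if_then_else_)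
open import Data.Fin as Fin using (toℕ)
import Data.Fin.Subset as Sub
import Data.Fin.Subset.Properties as SubP
open import Data.Vec.Base using (here; there; []; _∷_)
open import Data.Product using (_,_; proj₁; proj₂; ∃-syntax)
open import Data.Sum using (inj₁; inj₂; [_,_]′)
open import Data.Empty using (⊥-elim)
open import Data.Rational as ℚ using (_-_; -_)
import Data.Rational.Properties as ℚP
open import Data.List using (List; []; _∷_; _++_; map; length; filter; foldr; concat; allFin)
import Data.List.Properties as LP
open import Data.List.Relation.Unary.All as All using (All; []; _∷_; all?)
import Data.List.Relation.Unary.All.Properties as AllP
open import Data.List.Relation.Unary.Any as Any using (here; there)
open import Data.List.Relation.Unary.AllPairs as AllPairs using (_∷_)
open import Data.List.Membership.Propositional using (_∈_; lose)
import Data.List.Membership.Propositional.Properties as MP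
import Data.List.Membership.DecPropositional as MemD
open import Data.List.Relation.Unary.Unique.Propositional using (Unique)
import Data.List.Relation.Unary.Unique.Propositional.Properties as UniqueP
open import Data.List.Relation.Binary.Permutation.Propositional.Properties using (shifts; ∈-resp-↭)
open import Relation.Nullary using (¬_; Dec; yes; no; does; ¬?)
open import Relation.Nullary.Decidable using (_×-dec_; dec⇒maybe; from-yes)
open import Relation.Binary.Definitions using (DecidableEquality)
open import Relation.Binary.PropositionalEquality using (_≢_; refl; sym; trans; cong; cong₂; subst; subst₂; module ≡-Reasoning)
open import Function using (_∘_)
open import Level using (0ℓ)
open import Tactic.RingSolver using (solve-∀)
import Tactic.RingSolver.Core.AlmostCommutativeRing as ACR

ℚ-ring : ACR.AlmostCommutativeRing 0ℓ 0ℓ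
ℚ-ring = ACR.fromCommutativeRing ℚP.+-*-commutativeRing (λ x → dec⇒maybe (0ℚ ℚ.≟ x))

productℚ : List ℚ → ℚ
productℚ = foldr _*_ 1ℚ

sumℚ-++ : ∀ (xs ys : List ℚ) → sumℚ (xs ++ ys) ≡ sumℚ xs + sumℚ ys
sumℚ-++ []       ys = sym (ℚP.+-identityˡ _)
sumℚ-++ (x ∷ xs) ys = trans (cong (x +_) (sumℚ-++ xs ys)) (sym (ℚP.+-assoc x _ _))

module _ {B : Set} where

  sumℚ-map-+ : ∀ (f g : B → ℚ) xs → sumℚ (map (λ x → f x + g x) xs) ≡ sumℚ (map f xs) + sumℚ (map g xs)
  sumℚ-map-+ f g []       = refl
  sumℚ-map-+ f g (x ∷ xs) = trans (cong (f x + g x +_) (sumℚ-map-+ f g xs)) (interchange (f x) (g x) _ _)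
    where
    interchange : ∀ a b c d → (a + b) + (c + d) ≡ (a + c) + (b + d)
    interchange = solve-∀ ℚ-ring

  sumℚ-map-*ˡ : ∀ c (f : B → ℚ) xs → sumℚ (map (λ x → c * f x) xs) ≡ c * sumℚ (map f xs)
  sumℚ-map-*ˡ c f []       = sym (ℚP.*-zeroʳ c)
  sumℚ-map-*ˡ c f (x ∷ xs) = trans (cong (c * f x +_) (sumℚ-map-*ˡ c f xs)) (sym (ℚP.*-distribˡ-+ c _ _))

  sumℚ-map-zero : ∀ (f : B → ℚ) {xs} → All (λ x → f x ≡ 0ℚ) xs → sumℚ (map f xs) ≡ 0ℚ
  sumℚ-map-zero f []         = refl
  sumℚ-map-zero f (eq ∷ eqs) = cong₂ _+_ eq (sumℚ-map-zero f eqs)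

^ᵠ-+ : ∀ x a b → x ^ᵠ (a ℕ.+ b) ≡ x ^ᵠ a * x ^ᵠ b
^ᵠ-+ x zero    b = sym (ℚP.*-identityˡ _)
^ᵠ-+ x (suc a) b = trans (cong (x *_) (^ᵠ-+ x a b)) (sym (ℚP.*-assoc x _ _))

^ᵠ-nonNeg : ∀ {x} a → 0ℚ ≤ℚ x → 0ℚ ≤ℚ x ^ᵠ a
^ᵠ-nonNeg     zero    0≤x = ℚP.nonNegative⁻¹ 1ℚ
^ᵠ-nonNeg {x} (suc a) 0≤x = ℚP.nonNegative⁻¹ _
  {{ℚP.nonNeg*nonNeg⇒nonNeg x {{ℚ.nonNegative 0≤x}} (x ^ᵠ a) {{ℚ.nonNegative (^ᵠ-nonNeg a 0≤x)}}}}

^ᵠ-antitone : ∀ {x a b} → 0ℚ ≤ℚ x → x ≤ℚ 1ℚ → a ≤ b → x ^ᵠ b ≤ℚ x ^ᵠ a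
^ᵠ-antitone {x} {a} {b} 0≤x x≤1 a≤b = go (ℕP.≤⇒≤′ a≤b)
  where
  go : ∀ {c} → a ℕ.≤′ c → x ^ᵠ c ≤ℚ x ^ᵠ a
  go ℕ.≤′-refl           = ℚP.≤-refl
  go (ℕ.≤′-step {c} a≤c) = ℚP.≤-trans shrink (go a≤c)
    where
    shrink : x * x ^ᵠ c ≤ℚ x ^ᵠ c
    shrink = ℚP.≤-trans (ℚP.*-monoʳ-≤-nonNeg (x ^ᵠ c) {{ℚ.nonNegative (^ᵠ-nonNeg c 0≤x)}} x≤1)
                        (ℚP.≤-reflexive (ℚP.*-identityˡ _))

1≤^ᵠ : ∀ {x} n → 1ℚ ≤ℚ x → 1ℚ ≤ℚ x ^ᵠ n
1≤^ᵠ     zero    1≤x = ℚP.≤-refl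
1≤^ᵠ {x} (suc n) 1≤x = ℚP.≤-trans (1≤^ᵠ n 1≤x)
  (ℚP.≤-trans (ℚP.≤-reflexive (sym (ℚP.*-identityˡ _)))
              (ℚP.*-monoʳ-≤-nonNeg (x ^ᵠ n) {{ℚ.nonNegative xⁿ≥0}} 1≤x))
  where
  xⁿ≥0 : 0ℚ ≤ℚ x ^ᵠ n
  xⁿ≥0 = ℚP.≤-trans (ℚP.nonNegative⁻¹ 1ℚ) (1≤^ᵠ n 1≤x)

length-concat : ∀ {B : Set} ℓ (xss : List (List B)) → All (λ xs → length xs ≡ ℓ) xss →
                length (concat xss) ≡ length xss ℕ.* ℓ
length-concat ℓ []         []                = refl
length-concat ℓ (xs ∷ xss) (|xs|≡ℓ ∷ |xss|≡ℓ) = trans (LP.length-++ xs) (cong₂ ℕ._+_ |xs|≡ℓ (length-concat ℓ xss |xss|≡ℓ))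

p≤q⇒0≤q-p : ∀ {p q} → p ≤ℚ q → 0ℚ ≤ℚ q - p
p≤q⇒0≤q-p {p} {q} p≤q = subst (_≤ℚ q - p) (ℚP.+-inverseʳ p) (ℚP.+-monoˡ-≤ (- p) p≤q)

∣x∣≤2^n*x : ∀ {x} n → 0ℚ ≤ℚ x → ∣ x ∣ ≤ℚ (1ℚ + 1ℚ) ^ᵠ n * x
∣x∣≤2^n*x {x} n 0≤x = begin
  ∣ x ∣                   ≡⟨ ℚP.0≤p⇒∣p∣≡p 0≤x ⟩
  x                       ≡⟨ ℚP.*-identityˡ x ⟨
  1ℚ * x                  ≤⟨ ℚP.*-monoʳ-≤-nonNeg x {{ℚ.nonNegative 0≤x}} (1≤^ᵠ n (from-yes (1ℚ ℚ.≤? 1ℚ + 1ℚ))) ⟩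
  (1ℚ + 1ℚ) ^ᵠ n * x      ∎
  where open ℚP.≤-Reasoning

𝟙 : ∀ {P : Set} → Dec P → ℚ
𝟙 d = if does d then 1ℚ else 0ℚ

𝟙-cong : ∀ {P Q : Set} → (P → Q) → (Q → P) → (d : Dec P) (e : Dec Q) → 𝟙 d ≡ 𝟙 e
𝟙-cong P→Q Q→P (yes _) (yes _) = refl
𝟙-cong P→Q Q→P (yes p) (no ¬q) = ⊥-elim (¬q (P→Q p))
𝟙-cong P→Q Q→P (no ¬p) (yes q) = ⊥-elim (¬p (Q→P q))
𝟙-cong P→Q Q→P (no _)  (no _)  = refl

𝟙-no : ∀ {P : Set} (d : Dec P) → ¬ P → 𝟙 d ≡ 0ℚ
𝟙-no (yes p) ¬p = ⊥-elim (¬p p)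
𝟙-no (no _)  _  = refl

𝟙-× : ∀ {P Q : Set} (d : Dec P) (e : Dec Q) → 𝟙 (d ×-dec e) ≡ 𝟙 d * 𝟙 e
𝟙-× (yes _) (yes _) = sym (ℚP.*-identityˡ 1ℚ)
𝟙-× (yes _) (no _)  = sym (ℚP.*-identityˡ 0ℚ)
𝟙-× (no _)  e       = sym (ℚP.*-zeroˡ (𝟙 e))

module Counting {T : Set} (_≟_ : DecidableEquality T) where
  open import Data.List.Relation.Binary.Subset.Propositional {A = T} using (_⊆_)

  _∖_ : List T → T → List T
  xs ∖ x = filter (λ y → ¬? (y ≟ x)) xs

  ∈-∖⁺ : ∀ {x y xs} → y ∈ xs → y ≢ x → y ∈ xs ∖ x
  ∈-∖⁺ {x} = MP.∈-filter⁺ (λ y → ¬? (y ≟ x))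

  ∈-∖⁻ : ∀ {x y} xs → y ∈ xs ∖ x → y ∈ xs × y ≢ x
  ∈-∖⁻ {x} xs = MP.∈-filter⁻ (λ y → ¬? (y ≟ x)) {xs = xs}

  ⊆∷⇒∖⊆ : ∀ {x B G} → B ⊆ x ∷ G → B ∖ x ⊆ G
  ⊆∷⇒∖⊆ {B = B} B⊆x∷G e∈B∖x with e∈B , e≢x ← ∈-∖⁻ B e∈B∖x = Any.tail e≢x (B⊆x∷G e∈B)

  ∖⊆⇒⊆∷ : ∀ {x B G} → B ∖ x ⊆ G → B ⊆ x ∷ G
  ∖⊆⇒⊆∷ {x} B∖x⊆G {e} e∈B with e ≟ x
  ... | yes e≡x = here e≡x
  ... | no  e≢x = there (B∖x⊆G (∈-∖⁺ e∈B e≢x))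

  ++-⊆ : ∀ {xs ys zs} → xs ⊆ zs → ys ⊆ zs → xs ++ ys ⊆ zs
  ++-⊆ {xs} xs⊆zs ys⊆zs e∈ = [ xs⊆zs , ys⊆zs ]′ (MP.∈-++⁻ xs e∈)

  unique-⊆⇒length≤ : ∀ {xs ys : List T} → Unique xs → xs ⊆ ys → length xs ≤ length ys
  unique-⊆⇒length≤ {[]}     _            _     = z≤n
  unique-⊆⇒length≤ {x ∷ xs} {ys} (x∉xs ∷ u) xs⊆ys =
    ℕP.≤-trans (s≤s (unique-⊆⇒length≤ u xs⊆ys∖x))
               (LP.filter-notAll (λ y → ¬? (y ≟ x)) ys (Any.map (λ x≡y y≢x → y≢x (sym x≡y)) (xs⊆ys (here refl))))
    where
    xs⊆ys∖x : xs ⊆ ys ∖ x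
    xs⊆ys∖x y∈xs = ∈-∖⁺ (xs⊆ys (there y∈xs)) (λ y≡x → All.lookup x∉xs y∈xs (sym y≡x))

  open MemD _≟_ using (_∈?_)

  count : List T → List T → ℕ
  count L B = length (filter (_∈? B) L)

  count-≤-++ : ∀ {L B} C D → Unique L → B ⊆ C ++ D → count L B ≤ length C ℕ.+ count L D
  count-≤-++ {L} {B} C D uL B⊆C++D = ℕP.≤-trans
    (unique-⊆⇒length≤ (UniqueP.filter⁺ (_∈? B) uL) sub)
    (ℕP.≤-reflexive (LP.length-++ C))
    where
    sub : filter (_∈? B) L ⊆ C ++ filter (_∈? D) L
    sub e∈ with MP.∈-filter⁻ (_∈? B) {xs = L} e∈
    ... | e∈L , e∈B with MP.∈-++⁻ C (B⊆C++D e∈B)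
    ...   | inj₁ e∈C = MP.∈-++⁺ˡ e∈C
    ...   | inj₂ e∈D = MP.∈-++⁺ʳ C (MP.∈-filter⁺ (_∈? D) e∈L e∈D)

  count-≤-length : ∀ {L} B → Unique L → count L B ≤ length B
  count-≤-length {L} B uL = unique-⊆⇒length≤ (UniqueP.filter⁺ (_∈? B) uL) (proj₂ ∘ MP.∈-filter⁻ (_∈? B) {xs = L})

  count-≡-length : ∀ {L B} → Unique L → Unique B → B ⊆ L → count L B ≡ length B
  count-≡-length {L} {B} uL uB B⊆L = ℕP.≤-antisym (count-≤-length B uL)
    (unique-⊆⇒length≤ uB (λ e∈B → MP.∈-filter⁺ (_∈? B) (B⊆L e∈B) e∈B))

  count-[] : ∀ {L} → Unique L → count L [] ≡ 0
  count-[] uL = ℕP.n≤0⇒n≡0 (count-≤-length [] uL)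

  count-cong : ∀ {L B C} → All (λ e → (e ∈ B → e ∈ C) × (e ∈ C → e ∈ B)) L → count L B ≡ count L C
  count-cong {[]}    []                    = refl
  count-cong {e ∷ L} {B} {C} ((B⇒C , C⇒B) ∷ eqs) with e ∈? B
  ... | yes e∈B = trans (cong suc (count-cong eqs)) (cong length (sym (LP.filter-accept (_∈? C) (B⇒C e∈B))))
  ... | no  e∉B = trans (count-cong eqs) (cong length (sym (LP.filter-reject (_∈? C) (e∉B ∘ C⇒B))))

module Binomial {T : Set} (_≟_ : DecidableEquality T) (p : ℚ) where
  open Counting _≟_
  open MemD _≟_ using (_∈?_)
  open import Data.List.Relation.Binary.Subset.Propositional {A = T} using (_⊆_)

  weight : List T → List T → ℚ
  weight L G = p ^ᵠ length G * (1ℚ - p) ^ᵠ (length L ∸ length G)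

  E : List T → (List T → ℚ) → ℚ
  E L f = sumℚ (map (λ G → weight L G * f G) (subsets L))

  subsets-⊆ : ∀ L → All (λ G → length G ≤ length L × G ⊆ L) (subsets L)
  subsets-⊆ []       = (z≤n , λ {_} ()) ∷ []
  subsets-⊆ (x ∷ xs) = AllP.++⁺
    (All.map (λ (|G|≤ , G⊆xs) → ℕP.m≤n⇒m≤1+n |G|≤ , λ {_} e∈G → there (G⊆xs e∈G)) (subsets-⊆ xs))
    (AllP.map⁺ (All.map (λ (|G|≤ , G⊆xs) → s≤s |G|≤ , λ { {_} (here e≡x) → here e≡x ; {_} (there e∈G) → there (G⊆xs e∈G) })
                        (subsets-⊆ xs)))

  E-cong : ∀ L {f g} → (∀ G → G ⊆ L → f G ≡ g G) → E L f ≡ E L g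
  E-cong L f≡g = cong sumℚ (LP.map-cong-local (All.map (λ {G} (_ , G⊆L) → cong (weight L G *_) (f≡g G G⊆L)) (subsets-⊆ L)))

  E-vanishes : ∀ L {f} → (∀ G → G ⊆ L → f G ≡ 0ℚ) → E L f ≡ 0ℚ
  E-vanishes L {f} f≡0 = sumℚ-map-zero (λ G → weight L G * f G)
    (All.map (λ {G} (_ , G⊆L) → trans (cong (weight L G *_) (f≡0 G G⊆L)) (ℚP.*-zeroʳ (weight L G))) (subsets-⊆ L))

  E-+ : ∀ L f g → E L (λ G → f G + g G) ≡ E L f + E L g
  E-+ L f g = trans (cong sumℚ (LP.map-cong (λ G → ℚP.*-distribˡ-+ (weight L G) (f G) (g G)) (subsets L)))
                    (sumℚ-map-+ _ _ (subsets L))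

  E-*ˡ : ∀ L c f → E L (λ G → c * f G) ≡ c * E L f
  E-*ˡ L c f = trans (cong sumℚ (LP.map-cong (λ G → swap (weight L G) c (f G)) (subsets L)))
                     (sumℚ-map-*ˡ c _ (subsets L))
    where
    swap : ∀ a b d → a * (b * d) ≡ b * (a * d)
    swap = solve-∀ ℚ-ring

  E-∷ : ∀ x xs f → E (x ∷ xs) f ≡ (1ℚ - p) * E xs f + p * E xs (λ G → f (x ∷ G))
  E-∷ x xs f = begin
    E (x ∷ xs) f
      ≡⟨ cong sumℚ (LP.map-++ w (subsets xs) _) ⟩
    sumℚ (map w (subsets xs) ++ map w (map (x ∷_) (subsets xs)))
      ≡⟨ sumℚ-++ (map w (subsets xs)) _ ⟩
    sumℚ (map w (subsets xs)) + sumℚ (map w (map (x ∷_) (subsets xs)))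
      ≡⟨ cong₂ _+_ without-x with-x ⟩
    (1ℚ - p) * E xs f + p * E xs (λ G → f (x ∷ G)) ∎
    where
    open ≡-Reasoning
    w : List T → ℚ
    w G = weight (x ∷ xs) G * f G

    reassoc : ∀ a b c d → a * (b * c) * d ≡ b * (a * c * d)
    reassoc = solve-∀ ℚ-ring

    without-x : sumℚ (map w (subsets xs)) ≡ (1ℚ - p) * E xs f
    without-x = trans (cong sumℚ (LP.map-cong-local (All.map (λ {G} (|G|≤ , _) → factor G |G|≤) (subsets-⊆ xs))))
                      (sumℚ-map-*ˡ (1ℚ - p) _ (subsets xs))
      where
      factor : ∀ G → length G ≤ length xs → w G ≡ (1ℚ - p) * (weight xs G * f G)
      factor G |G|≤ = trans (cong (λ m → p ^ᵠ length G * (1ℚ - p) ^ᵠ m * f G) (ℕP.+-∸-assoc 1 |G|≤))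
                            (reassoc (p ^ᵠ length G) (1ℚ - p) _ (f G))

    with-x : sumℚ (map w (map (x ∷_) (subsets xs))) ≡ p * E xs (λ G → f (x ∷ G))
    with-x = trans (cong sumℚ (sym (LP.map-∘ (subsets xs))))
             (trans (cong sumℚ (LP.map-cong (λ G → trans (cong (_* f (x ∷ G)) (ℚP.*-assoc p _ _))
                                                         (ℚP.*-assoc p _ (f (x ∷ G)))) (subsets xs)))
                    (sumℚ-map-*ˡ p _ (subsets xs)))

  𝟙[_⊆_] : List T → List T → ℚ
  𝟙[ B ⊆ G ] = 𝟙 (all? (_∈? G) B)

  𝟙-⊆-cong : ∀ {B G C H} → (B ⊆ G → C ⊆ H) → (C ⊆ H → B ⊆ G) → 𝟙[ B ⊆ G ] ≡ 𝟙[ C ⊆ H ]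
  𝟙-⊆-cong {B} {G} {C} {H} ⇒ ⇐ =
    𝟙-cong (λ h → All.tabulate (⇒ (All.lookup h))) (λ h → All.tabulate (⇐ (All.lookup h)))
           (all? (_∈? G) B) (all? (_∈? H) C)

  𝟙-⊆-++ : ∀ B C G → 𝟙[ B ++ C ⊆ G ] ≡ 𝟙[ B ⊆ G ] * 𝟙[ C ⊆ G ]
  𝟙-⊆-++ B C G = trans (𝟙-cong (AllP.++⁻ {P = _∈ G} B) (λ (b , c) → AllP.++⁺ b c) (all? (_∈? G) (B ++ C)) (B? ×-dec C?))
                       (𝟙-× B? C?)
    where
    B? = all? (_∈? G) B
    C? = all? (_∈? G) C

  𝟙-⊆-∷ : ∀ {x} B G → 𝟙[ B ⊆ x ∷ G ] ≡ 𝟙[ B ∖ x ⊆ G ]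
  𝟙-⊆-∷ {x} B G = 𝟙-⊆-cong {B} {x ∷ G} {B ∖ x} {G} ⊆∷⇒∖⊆ ∖⊆⇒⊆∷

  E-𝟙 : ∀ L B → Unique L → B ⊆ L → E L (λ G → 𝟙[ B ⊆ G ]) ≡ p ^ᵠ count L B
  E-𝟙 []       []      _ _    = refl
  E-𝟙 []       (b ∷ B) _ B⊆[] with () ← B⊆[] (here refl)
  E-𝟙 (x ∷ xs) B (x∉xs ∷ uxs) B⊆x∷xs = begin
    E (x ∷ xs) 𝟙B
      ≡⟨ E-∷ x xs 𝟙B ⟩
    (1ℚ - p) * E xs 𝟙B + p * E xs (λ G → 𝟙[ B ⊆ x ∷ G ])
      ≡⟨ cong (λ a → (1ℚ - p) * E xs 𝟙B + p * a) with-x ⟩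
    (1ℚ - p) * E xs 𝟙B + p * p ^ᵠ count xs B
      ≡⟨ without-x (x ∈? B) ⟩
    p ^ᵠ count (x ∷ xs) B ∎
    where
    open ≡-Reasoning
    𝟙B : List T → ℚ
    𝟙B G = 𝟙[ B ⊆ G ]

    with-x : E xs (λ G → 𝟙[ B ⊆ x ∷ G ]) ≡ p ^ᵠ count xs B
    with-x = begin
      E xs (λ G → 𝟙[ B ⊆ x ∷ G ]) ≡⟨ E-cong xs (λ G _ → 𝟙-⊆-∷ B G) ⟩
      E xs (λ G → 𝟙[ B ∖ x ⊆ G ]) ≡⟨ E-𝟙 xs (B ∖ x) uxs (⊆∷⇒∖⊆ B⊆x∷xs) ⟩
      p ^ᵠ count xs (B ∖ x)         ≡⟨ cong (p ^ᵠ_) (count-cong (All.map ∖-agrees x∉xs)) ⟩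
      p ^ᵠ count xs B               ∎
      where
      ∖-agrees : ∀ {e} → x ≢ e → (e ∈ B ∖ x → e ∈ B) × (e ∈ B → e ∈ B ∖ x)
      ∖-agrees x≢e = proj₁ ∘ ∈-∖⁻ B , λ e∈B → ∈-∖⁺ e∈B (x≢e ∘ sym)

    without-x : Dec (x ∈ B) → (1ℚ - p) * E xs 𝟙B + p * p ^ᵠ count xs B ≡ p ^ᵠ count (x ∷ xs) B
    without-x (yes x∈B) = begin
      (1ℚ - p) * E xs 𝟙B + p * p ^ᵠ count xs B
        ≡⟨ cong (λ a → (1ℚ - p) * a + p * p ^ᵠ count xs B) (E-vanishes xs B⊈G) ⟩
      (1ℚ - p) * 0ℚ + p * p ^ᵠ count xs B
        ≡⟨ only-present p _ ⟩
      p ^ᵠ suc (count xs B)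
        ≡⟨ cong (λ ys → p ^ᵠ length ys) (LP.filter-accept (_∈? B) x∈B) ⟨
      p ^ᵠ count (x ∷ xs) B ∎
      where
      only-present : ∀ a b → (1ℚ - a) * 0ℚ + a * b ≡ a * b
      only-present = solve-∀ ℚ-ring
      B⊈G : ∀ G → G ⊆ xs → 𝟙[ B ⊆ G ] ≡ 0ℚ
      B⊈G G G⊆xs = 𝟙-no (all? (_∈? G) B) (λ B⊆G → All.lookup x∉xs (G⊆xs (All.lookup B⊆G x∈B)) refl)
    without-x (no x∉B) = begin
      (1ℚ - p) * E xs 𝟙B + p * p ^ᵠ count xs B
        ≡⟨ cong (λ a → (1ℚ - p) * a + p * p ^ᵠ count xs B) (E-𝟙 xs B uxs B⊆xs) ⟩
      (1ℚ - p) * p ^ᵠ count xs B + p * p ^ᵠ count xs B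
        ≡⟨ convex p _ ⟩
      p ^ᵠ count xs B
        ≡⟨ cong (λ ys → p ^ᵠ length ys) (LP.filter-reject (_∈? B) x∉B) ⟨
      p ^ᵠ count (x ∷ xs) B ∎
      where
      convex : ∀ a b → (1ℚ - a) * b + a * b ≡ b
      convex = solve-∀ ℚ-ring
      B⊆xs : B ⊆ xs
      B⊆xs e∈B = Any.tail (λ e≡x → x∉B (subst (_∈ B) e≡x e∈B)) (B⊆x∷xs e∈B)

  centred : List T → List T → ℚ
  centred B G = 𝟙[ B ⊆ G ] - p ^ᵠ length B

  Π : List (List T) → List T → ℚ
  Π Bs G = productℚ (map (λ B → centred B G) Bs)

  E-𝟙-Π-∷ : ∀ L A B Bs →
    E L (λ G → 𝟙[ A ⊆ G ] * Π (B ∷ Bs) G)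
      ≡ E L (λ G → 𝟙[ A ++ B ⊆ G ] * Π Bs G) - p ^ᵠ length B * E L (λ G → 𝟙[ A ⊆ G ] * Π Bs G)
  E-𝟙-Π-∷ L A B Bs = begin
    E L (λ G → 𝟙[ A ⊆ G ] * Π (B ∷ Bs) G)                  ≡⟨ E-cong L (λ G _ → expand G) ⟩
    E L (λ G → f G + (- q) * g G)                            ≡⟨ E-+ L f (λ G → (- q) * g G) ⟩
    E L f + E L (λ G → (- q) * g G)                          ≡⟨ cong (E L f +_) (E-*ˡ L (- q) g) ⟩
    E L f + (- q) * E L g                                    ≡⟨ cong (E L f +_) (ℚP.neg-distribˡ-* q (E L g)) ⟨
    E L f - q * E L g                                        ∎
    where
    open ≡-Reasoning
    q = p ^ᵠ length B
    f g : List T → ℚ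
    f G = 𝟙[ A ++ B ⊆ G ] * Π Bs G
    g G = 𝟙[ A ⊆ G ] * Π Bs G
    distrib : ∀ a b c d → a * ((b - c) * d) ≡ a * b * d + (- c) * (a * d)
    distrib = solve-∀ ℚ-ring
    expand : ∀ G → 𝟙[ A ⊆ G ] * Π (B ∷ Bs) G ≡ f G + (- q) * g G
    expand G = trans (distrib 𝟙[ A ⊆ G ] 𝟙[ B ⊆ G ] q (Π Bs G))
                     (cong (λ a → a * Π Bs G + (- q) * g G) (sym (𝟙-⊆-++ A B G)))

  E-Π≡E-𝟙[]-Π : ∀ L Bs → E L (Π Bs) ≡ E L (λ G → 𝟙[ [] ⊆ G ] * Π Bs G)
  E-Π≡E-𝟙[]-Π L Bs = E-cong L (λ G _ → sym (ℚP.*-identityˡ (Π Bs G)))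

  -- p̌ and the conclusion of lemma10, with ñ_C and m̃_C abstracted.
  p̌′ : ℕ → ℕ → ℕ → ℚ
  p̌′ ℓ ñ m̃ = if does (ñ ℕ.≤? 2) then p ^ᵠ m̃ - p ^ᵠ (ñ ℕ.* ℓ) else p ^ᵠ m̃

  MomentBounds : ℕ → ℕ → ℕ → ℚ → Set
  MomentBounds ℓ ñ m̃ μ =
    (∣ μ ∣ ≤ℚ (1ℚ + 1ℚ) ^ᵠ ñ * p̌′ ℓ ñ m̃) × (ñ ≤ 2 → μ ≡ p̌′ ℓ ñ m̃) × (ñ ≡ 1 → p̌′ ℓ ñ m̃ ≡ 0ℚ)

  module _ {L : List T} (uL : Unique L) where

    E-𝟙-Π-[] : ∀ A → A ⊆ L → E L (λ G → 𝟙[ A ⊆ G ] * Π [] G) ≡ p ^ᵠ count L A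
    E-𝟙-Π-[] A A⊆L = trans (E-cong L (λ G _ → ℚP.*-identityʳ 𝟙[ A ⊆ G ])) (E-𝟙 L A uL A⊆L)

    E-𝟙-Π-[_] : ∀ {A} B → A ⊆ L → B ⊆ L →
      E L (λ G → 𝟙[ A ⊆ G ] * Π (B ∷ []) G) ≡ p ^ᵠ count L (A ++ B) - p ^ᵠ length B * p ^ᵠ count L A
    E-𝟙-Π-[_] {A} B A⊆L B⊆L =
      trans (E-𝟙-Π-∷ L A B [])
            (cong₂ (λ a b → a - p ^ᵠ length B * b) (E-𝟙-Π-[] (A ++ B) (++-⊆ A⊆L B⊆L)) (E-𝟙-Π-[] A A⊆L))

    E-Π-singleton : ∀ {B} → Unique B → B ⊆ L → E L (Π (B ∷ [])) ≡ 0ℚ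
    E-Π-singleton {B} uB B⊆L = begin
      E L (Π (B ∷ []))                        ≡⟨ E-Π≡E-𝟙[]-Π L (B ∷ []) ⟩
      E L (λ G → 𝟙[ [] ⊆ G ] * Π (B ∷ []) G)  ≡⟨ E-𝟙-Π-[ B ] (λ {_} ()) B⊆L ⟩
      p ^ᵠ count L B - q * p ^ᵠ count L []     ≡⟨ cong₂ (λ a b → p ^ᵠ a - q * p ^ᵠ b) (count-≡-length uL uB B⊆L) (count-[] uL) ⟩
      q - q * 1ℚ                               ≡⟨ cancel q ⟩
      0ℚ                                       ∎
      where
      open ≡-Reasoning
      q = p ^ᵠ length B
      cancel : ∀ a → a - a * 1ℚ ≡ 0ℚ
      cancel = solve-∀ ℚ-ring

    E-Π-pair : ∀ {B C} → Unique B → Unique C → B ⊆ L → C ⊆ L →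
      E L (Π (B ∷ C ∷ [])) ≡ p ^ᵠ count L (B ++ C) - p ^ᵠ length B * p ^ᵠ length C
    E-Π-pair {B} {C} uB uC B⊆L C⊆L = begin
      E L (Π (B ∷ C ∷ []))
        ≡⟨ E-Π≡E-𝟙[]-Π L (B ∷ C ∷ []) ⟩
      E L (λ G → 𝟙[ [] ⊆ G ] * Π (B ∷ C ∷ []) G)
        ≡⟨ E-𝟙-Π-∷ L [] B (C ∷ []) ⟩
      E L (λ G → 𝟙[ B ⊆ G ] * Π (C ∷ []) G) - qB * E L (λ G → 𝟙[ [] ⊆ G ] * Π (C ∷ []) G)
        ≡⟨ cong₂ (λ a b → a - qB * b) (E-𝟙-Π-[ C ] B⊆L C⊆L)
                 (trans (sym (E-Π≡E-𝟙[]-Π L (C ∷ []))) (E-Π-singleton uC C⊆L)) ⟩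
      (p ^ᵠ count L (B ++ C) - qC * p ^ᵠ count L B) - qB * 0ℚ
        ≡⟨ cong (λ c → (p ^ᵠ count L (B ++ C) - qC * p ^ᵠ c) - qB * 0ℚ) (count-≡-length uL uB B⊆L) ⟩
      (p ^ᵠ count L (B ++ C) - qC * qB) - qB * 0ℚ
        ≡⟨ reorder (p ^ᵠ count L (B ++ C)) qB qC ⟩
      p ^ᵠ count L (B ++ C) - qB * qC ∎
      where
      open ≡-Reasoning
      qB = p ^ᵠ length B
      qC = p ^ᵠ length C
      reorder : ∀ a b c → (a - c * b) - b * 0ℚ ≡ a - b * c
      reorder = solve-∀ ℚ-ring

    module _ (0≤p : 0ℚ ≤ℚ p) (p≤1 : p ≤ℚ 1ℚ) where

      ∣E-𝟙-Π∣≤ : ∀ A Bs → A ⊆ L → All (_⊆ L) Bs →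
        ∣ E L (λ G → 𝟙[ A ⊆ G ] * Π Bs G) ∣ ≤ℚ (1ℚ + 1ℚ) ^ᵠ length Bs * p ^ᵠ count L (A ++ concat Bs)
      ∣E-𝟙-Π∣≤ A [] A⊆L [] = begin
        ∣ E L (λ G → 𝟙[ A ⊆ G ] * Π [] G) ∣  ≡⟨ cong ∣_∣ (E-𝟙-Π-[] A A⊆L) ⟩
        ∣ p ^ᵠ count L A ∣                    ≡⟨ ℚP.0≤p⇒∣p∣≡p (^ᵠ-nonNeg (count L A) 0≤p) ⟩
        p ^ᵠ count L A                        ≡⟨ ℚP.*-identityˡ _ ⟨
        1ℚ * p ^ᵠ count L A                   ≡⟨ cong (λ A′ → 1ℚ * p ^ᵠ count L A′) (LP.++-identityʳ A) ⟨
        1ℚ * p ^ᵠ count L (A ++ []) ∎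
        where open ℚP.≤-Reasoning
      ∣E-𝟙-Π∣≤ A (B ∷ Bs) A⊆L (B⊆L ∷ Bs⊆L) = begin
        ∣ E L (λ G → 𝟙[ A ⊆ G ] * Π (B ∷ Bs) G) ∣  ≡⟨ cong ∣_∣ (E-𝟙-Π-∷ L A B Bs) ⟩
        ∣ E₁ - q * E₂ ∣                            ≤⟨ ℚP.∣p-q∣≤∣p∣+∣q∣ E₁ (q * E₂) ⟩
        ∣ E₁ ∣ + ∣ q * E₂ ∣                         ≡⟨ cong (∣ E₁ ∣ +_) ∣qE₂∣≡q∣E₂∣ ⟩
        ∣ E₁ ∣ + q * ∣ E₂ ∣                         ≤⟨ ℚP.+-mono-≤ IH₁ (ℚP.*-monoˡ-≤-nonNeg q {{ℚ.nonNegative q≥0}} IH₂) ⟩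
        2ʳ * p ^ᵠ c + q * (2ʳ * p ^ᵠ c′)           ≡⟨ cong (2ʳ * p ^ᵠ c +_) absorb-q ⟩
        2ʳ * p ^ᵠ c + 2ʳ * p ^ᵠ (length B ℕ.+ c′)  ≤⟨ ℚP.+-monoʳ-≤ (2ʳ * p ^ᵠ c) (ℚP.*-monoˡ-≤-nonNeg 2ʳ {{ℚ.nonNegative 2ʳ≥0}} p^[|B|+c′]≤p^c) ⟩
        2ʳ * p ^ᵠ c + 2ʳ * p ^ᵠ c                  ≡⟨ double 2ʳ (p ^ᵠ c) ⟩
        (1ℚ + 1ℚ) * 2ʳ * p ^ᵠ c                    ∎
        where
        open ℚP.≤-Reasoning
        q  = p ^ᵠ length B
        2ʳ = (1ℚ + 1ℚ) ^ᵠ length Bs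
        E₁ = E L (λ G → 𝟙[ A ++ B ⊆ G ] * Π Bs G)
        E₂ = E L (λ G → 𝟙[ A ⊆ G ] * Π Bs G)
        c  = count L (A ++ (B ++ concat Bs))
        c′ = count L (A ++ concat Bs)
        q≥0 : 0ℚ ≤ℚ q
        q≥0 = ^ᵠ-nonNeg (length B) 0≤p
        2ʳ≥0 : 0ℚ ≤ℚ 2ʳ
        2ʳ≥0 = ^ᵠ-nonNeg (length Bs) (from-yes (0ℚ ℚ.≤? 1ℚ + 1ℚ))
        ∣qE₂∣≡q∣E₂∣ : ∣ q * E₂ ∣ ≡ q * ∣ E₂ ∣
        ∣qE₂∣≡q∣E₂∣ = trans (ℚP.∣p*q∣≡∣p∣*∣q∣ q E₂) (cong (_* ∣ E₂ ∣) (ℚP.0≤p⇒∣p∣≡p q≥0))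
        IH₁ : ∣ E₁ ∣ ≤ℚ 2ʳ * p ^ᵠ c
        IH₁ = subst (λ A′ → ∣ E₁ ∣ ≤ℚ 2ʳ * p ^ᵠ count L A′) (LP.++-assoc A B (concat Bs))
                    (∣E-𝟙-Π∣≤ (A ++ B) Bs (++-⊆ A⊆L B⊆L) Bs⊆L)
        IH₂ : ∣ E₂ ∣ ≤ℚ 2ʳ * p ^ᵠ c′
        IH₂ = ∣E-𝟙-Π∣≤ A Bs A⊆L Bs⊆L
        absorb-q : q * (2ʳ * p ^ᵠ c′) ≡ 2ʳ * p ^ᵠ (length B ℕ.+ c′)
        absorb-q = trans (swap q 2ʳ (p ^ᵠ c′)) (cong (2ʳ *_) (sym (^ᵠ-+ p (length B) c′)))
          where
          swap : ∀ a b d → a * (b * d) ≡ b * (a * d)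
          swap = solve-∀ ℚ-ring
        p^[|B|+c′]≤p^c : p ^ᵠ (length B ℕ.+ c′) ≤ℚ p ^ᵠ c
        p^[|B|+c′]≤p^c = ^ᵠ-antitone 0≤p p≤1 (count-≤-++ B (A ++ concat Bs) uL (∈-resp-↭ (shifts A B)))
        double : ∀ a b → a * b + a * b ≡ (1ℚ + 1ℚ) * a * b
        double = solve-∀ ℚ-ring

      moment-bounds : ∀ ℓ Bs → Bs ≢ [] → All (λ B → length B ≡ ℓ × Unique B × B ⊆ L) Bs →
        MomentBounds ℓ (length Bs) (count L (concat Bs)) (E L (Π Bs))
      moment-bounds ℓ [] []≢[] _ = ⊥-elim ([]≢[] refl)
      moment-bounds ℓ (B ∷ []) _ ((|B|≡ℓ , uB , B⊆L) ∷ []) =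
        ℚP.≤-trans (ℚP.≤-reflexive (cong ∣_∣ E≡p̌)) (∣x∣≤2^n*x 1 (subst (0ℚ ≤ℚ_) (sym p̌≡0) ℚP.≤-refl)) , (λ _ → E≡p̌) , (λ _ → p̌≡0)
        where
        p̌≡0 : p ^ᵠ count L (B ++ []) - p ^ᵠ (1 ℕ.* ℓ) ≡ 0ℚ
        p̌≡0 = trans (cong₂ (λ a b → p ^ᵠ a - p ^ᵠ b) count≡ℓ (ℕP.*-identityˡ ℓ)) (ℚP.+-inverseʳ (p ^ᵠ ℓ))
          where
          count≡ℓ : count L (B ++ []) ≡ ℓ
          count≡ℓ = trans (cong (count L) (LP.++-identityʳ B)) (trans (count-≡-length uL uB B⊆L) |B|≡ℓ)
        E≡p̌ : E L (Π (B ∷ [])) ≡ p ^ᵠ count L (B ++ []) - p ^ᵠ (1 ℕ.* ℓ)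
        E≡p̌ = trans (E-Π-singleton uB B⊆L) (sym p̌≡0)
      moment-bounds ℓ (B ∷ C ∷ []) _ ((|B|≡ℓ , uB , B⊆L) ∷ (|C|≡ℓ , uC , C⊆L) ∷ []) =
        ℚP.≤-trans (ℚP.≤-reflexive (cong ∣_∣ E≡p̌)) (∣x∣≤2^n*x 2 p̌≥0) , (λ _ → E≡p̌) , λ ()
        where
        c = count L (B ++ (C ++ []))
        c≤2ℓ : c ≤ 2 ℕ.* ℓ
        c≤2ℓ = ℕP.≤-trans (count-≤-length (B ++ (C ++ [])) uL)
                          (ℕP.≤-reflexive (length-concat ℓ (B ∷ C ∷ []) (|B|≡ℓ ∷ |C|≡ℓ ∷ [])))
        p̌≥0 : 0ℚ ≤ℚ p ^ᵠ c - p ^ᵠ (2 ℕ.* ℓ)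
        p̌≥0 = p≤q⇒0≤q-p (^ᵠ-antitone 0≤p p≤1 c≤2ℓ)
        qBqC≡p^2ℓ : p ^ᵠ length B * p ^ᵠ length C ≡ p ^ᵠ (2 ℕ.* ℓ)
        qBqC≡p^2ℓ = trans (sym (^ᵠ-+ p (length B) (length C)))
                          (cong (p ^ᵠ_) (cong₂ ℕ._+_ |B|≡ℓ (trans |C|≡ℓ (sym (ℕP.+-identityʳ ℓ)))))
        E≡p̌ : E L (Π (B ∷ C ∷ [])) ≡ p ^ᵠ c - p ^ᵠ (2 ℕ.* ℓ)
        E≡p̌ = trans (E-Π-pair uB uC B⊆L C⊆L)
                    (cong₂ (λ a b → p ^ᵠ a - b) (cong (λ C′ → count L (B ++ C′)) (sym (LP.++-identityʳ C))) qBqC≡p^2ℓ)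
      moment-bounds ℓ Bs@(_ ∷ _ ∷ _ ∷ _) _ shape = bound , (λ { (s≤s (s≤s ())) }) , λ ()
        where
        bound : ∣ E L (Π Bs) ∣ ≤ℚ (1ℚ + 1ℚ) ^ᵠ length Bs * p ^ᵠ count L (concat Bs)
        bound = ℚP.≤-trans (ℚP.≤-reflexive (cong ∣_∣ (E-Π≡E-𝟙[]-Π L Bs)))
                           (∣E-𝟙-Π∣≤ [] Bs (λ {_} ()) (All.map (proj₂ ∘ proj₂) shape))

select : ∀ {B : Set} {k} → Subset k → (Fin k → B) → List B
select []          f = []
select (true ∷ S)  f = f Fin.zero ∷ select S (f ∘ Fin.suc)
select (false ∷ S) f = select S (f ∘ Fin.suc)

length-select : ∀ {B : Set} {k} (S : Subset k) (f : Fin k → B) → length (select S f) ≡ Sub.∣ S ∣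
length-select []          f = refl
length-select (true ∷ S)  f = cong suc (length-select S (f ∘ Fin.suc))
length-select (false ∷ S) f = length-select S (f ∘ Fin.suc)

∈-select⁺ : ∀ {B : Set} {k} (S : Subset k) (f : Fin k → B) {j} → j Sub.∈ S → f j ∈ select S f
∈-select⁺ (true ∷ S)  f here        = here refl
∈-select⁺ (true ∷ S)  f (there j∈S) = there (∈-select⁺ S (f ∘ Fin.suc) j∈S)
∈-select⁺ (false ∷ S) f (there j∈S) = ∈-select⁺ S (f ∘ Fin.suc) j∈S

∈-select⁻ : ∀ {B : Set} {k} (S : Subset k) (f : Fin k → B) {x} → x ∈ select S f → ∃[ j ] j Sub.∈ S × x ≡ f j
∈-select⁻ (true ∷ S)  f (here x≡f0) = Fin.zero , here , x≡f0
∈-select⁻ (true ∷ S)  f (there x∈)  with j , j∈S , x≡fj ← ∈-select⁻ S (f ∘ Fin.suc) x∈ = Fin.suc j , there j∈S , x≡fj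
∈-select⁻ (false ∷ S) f x∈          with j , j∈S , x≡fj ← ∈-select⁻ S (f ∘ Fin.suc) x∈ = Fin.suc j , there j∈S , x≡fj

select-∘ : ∀ {B C : Set} {k} (S : Subset k) (f : Fin k → B) (g : B → C) → select S (g ∘ f) ≡ map g (select S f)
select-∘ []          f g = refl
select-∘ (true ∷ S)  f g = cong (g (f Fin.zero) ∷_) (select-∘ S (f ∘ Fin.suc) g)
select-∘ (false ∷ S) f g = select-∘ S (f ∘ Fin.suc) g

foldr-allFin-suc : ∀ {C : Set} {k} (h : Fin (suc k) → C → C) e →
  foldr h e (allFin (suc k)) ≡ h Fin.zero (foldr (λ j → h (Fin.suc j)) e (allFin k))
foldr-allFin-suc {k = k} h e =
  cong (h Fin.zero) (trans (cong (foldr h e) (sym (LP.map-tabulate (λ j → j) Fin.suc))) (LP.foldr-map h Fin.suc e (allFin k)))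

foldr-select : ∀ {k} (S : Subset k) (f : Fin k → ℚ) →
  foldr (λ j acc → (if does (j SubP.∈? S) then f j else 1ℚ) * acc) 1ℚ (allFin k) ≡ productℚ (select S f)
foldr-select []          f = refl
foldr-select (true ∷ S)  f =
  trans (foldr-allFin-suc (λ j acc → (if does (j SubP.∈? true ∷ S) then f j else 1ℚ) * acc) 1ℚ)
        (cong (f Fin.zero *_) (foldr-select S (f ∘ Fin.suc)))
foldr-select (false ∷ S) f =
  trans (foldr-allFin-suc (λ j acc → (if does (j SubP.∈? false ∷ S) then f j else 1ℚ) * acc) 1ℚ)
        (trans (ℚP.*-identityˡ _) (foldr-select S (f ∘ Fin.suc)))

module _ {n : ℕ} where
  open import Data.List.Relation.Binary.Subset.Propositional {A = Edge n} using (_⊆_)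
  open Counting (_≟ᴱ_ {n})
  open MemD (_≟ᴱ_ {n}) using (_∈?_)

  allEdges-unique : Unique (allEdges n)
  allEdges-unique = UniqueP.filter⁺ _ (UniqueP.cartesianProduct⁺ (UniqueP.allFin⁺ n) (UniqueP.allFin⁺ n))

  edges-⊆-allEdges : ∀ {ℓ} (M : Matching n ℓ) → edges M ⊆ allEdges n
  edges-⊆-allEdges M {a , b} e∈M = MP.∈-filter⁺ (λ e → toℕ (proj₁ e) ℕ.<? toℕ (proj₂ e))
    (MP.∈-cartesianProduct⁺ (MP.∈-allFin a) (MP.∈-allFin b)) (All.lookup (valid M) e∈M)

  edges-unique : ∀ {ℓ} (M : Matching n ℓ) → Unique (edges M)
  edges-unique M = AllPairs.map (λ a≢c×_ e≡e′ → proj₁ a≢c×_ (cong proj₁ e≡e′)) (disjoint M)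

  edges-shape : ∀ {ℓ} (Ms : List (Matching n ℓ)) →
    All (λ B → length B ≡ ℓ × Unique B × B ⊆ allEdges n) (map edges Ms)
  edges-shape Ms = AllP.map⁺ (All.universal (λ M → size M , edges-unique M , λ {_} → edges-⊆-allEdges M) Ms)

  module _ (p : ℚ) where
    open Binomial (_≟ᴱ_ {n}) p

    Y≡centred : ∀ {ℓ} (M : Matching n ℓ) G → Y p M G ≡ centred (edges M) G
    Y≡centred M G = cong (λ m → X M G - p ^ᵠ m) (sym (size M))

    Yᶜ≡Π : ∀ {ℓ k} (ms : Fin k → Matching n ℓ) S G → Yᶜ ms p S G ≡ Π (map edges (select S ms)) G
    Yᶜ≡Π ms S G = begin
      Yᶜ ms p S G
        ≡⟨ foldr-select S (λ j → Y p (ms j) G) ⟩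
      productℚ (select S (λ j → Y p (ms j) G))
        ≡⟨ cong productℚ (select-∘ S ms (λ M → Y p M G)) ⟩
      productℚ (map (λ M → Y p M G) (select S ms))
        ≡⟨ cong productℚ (LP.map-cong (λ M → Y≡centred M G) (select S ms)) ⟩
      productℚ (map (λ M → centred (edges M) G) (select S ms))
        ≡⟨ cong productℚ (LP.map-∘ (select S ms)) ⟩
      Π (map edges (select S ms)) G ∎
      where open ≡-Reasoning

  m̃≡count : ∀ {ℓ k} (ms : Fin k → Matching n ℓ) S → m̃ ms S ≡ count (allEdges n) (concat (map edges (select S ms)))
  m̃≡count {k = k} ms S = cong length (LP.filter-≐ _ (_∈? concat (map edges (select S ms))) (⇒ , ⇐) (allEdges n))
    where
    ⇒ : ∀ {e} → Any.Any (λ j → j Sub.∈ S × e ∈ edges (ms j)) (allFin k) → e ∈ concat (map edges (select S ms))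
    ⇒ any with j , j∈S , e∈ ← Any.satisfied any = MP.∈-concat⁺′ e∈ (MP.∈-map⁺ edges (∈-select⁺ S ms j∈S))
    ⇐ : ∀ {e} → e ∈ concat (map edges (select S ms)) → Any.Any (λ j → j Sub.∈ S × e ∈ edges (ms j)) (allFin k)
    ⇐ e∈ with es , e∈es , es∈ ← MP.∈-concat⁻′ (map edges (select S ms)) e∈
         with M , M∈ , refl ← MP.∈-map⁻ edges es∈
         with j , j∈S , refl ← ∈-select⁻ S ms M∈ = lose (MP.∈-allFin j) (j∈S , e∈es)

lemma10 : (n ℓ k : ℕ) (p : ℚ) → 1 ≤ n → 1 ≤ ℓ → 1 ≤ k → 0ℚ < p → p < 1ℚ →
    (ms : Fin k → Matching n ℓ) (S : Subset k) → IsComponent ms S →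
    (∣ 𝔼 n p (Yᶜ ms p S) ∣ ≤ℚ ((1ℚ + 1ℚ) ^ᵠ ñ ms S) * p̌ ms p S)
    × (ñ ms S ≤ 2 → 𝔼 n p (Yᶜ ms p S) ≡ p̌ ms p S)
    × (ñ ms S ≡ 1 → p̌ ms p S ≡ 0ℚ)
lemma10 n ℓ k p _ _ _ 0<p p<1 ms S ((j , j∈S) , _) =
  subst (MomentBounds ℓ (ñ ms S) (m̃ ms S)) (sym 𝔼≡E)
    (subst₂ (λ ñ′ m̃′ → MomentBounds ℓ ñ′ m̃′ (E (allEdges n) (Π Bs))) ñ≡ (sym (m̃≡count ms S))
      (moment-bounds allEdges-unique (ℚP.<⇒≤ 0<p) (ℚP.<⇒≤ p<1) ℓ Bs Bs≢[] (edges-shape (select S ms))))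
  where
  open Binomial (_≟ᴱ_ {n}) p
  Bs : List (List (Edge n))
  Bs = map edges (select S ms)
  ñ≡ : length Bs ≡ ñ ms S
  ñ≡ = trans (LP.length-map edges (select S ms)) (length-select S ms)
  𝔼≡E : 𝔼 n p (Yᶜ ms p S) ≡ E (allEdges n) (Π Bs)
  𝔼≡E = E-cong (allEdges n) (λ G _ → Yᶜ≡Π p ms S G)
  Bs≢[] : Bs ≢ []
  Bs≢[] Bs≡[] with () ← subst (edges (ms j) ∈_) Bs≡[] (MP.∈-map⁺ edges (∈-select⁺ S ms j∈S))
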